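{- Let $n\ge1$, let $m$ be a positive integer, let $\eta$ be a vector of integers in $\mathcal A^{\tilde A_{n-1}}_m=\{(x_1,\dots,x_n)\in\mathbb R^n: x_1>x_2>\dots>x_n>x_1-m\}$, and let $k\ge0$. Then the number of walks which start at $\eta$, consist of exactly $k$ standard steps in the positive direction, and stay in $\mathcal A^{\tilde A_{n-1}}_m$, equals $2^{ -k}$ times the number of walks which start at $\eta$, consist of exactly $k$ standard steps, and stay in $\mathcal A^{\tilde A_{n-1}}_m$ (end points arbitrary in both cases).
   Context: $e_j$ is the $j$-th standard unit vector of $\mathbb R^n$. A walk with $k$ steps with step set $S$ is a sequence $p_0,\dots,p_k$ with $p_i-p_{i-1}\in S$; "standard steps" means $S=\{\pm e_1,\dots,\pm e_n\}$, "standard steps in the positive direction" means $S=\{e_1,\dots,e_n\}$. The walk stays in $R$ if all $p_i\in R$. -}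

module Defs where

open import Data.Nat using (ℕ; zero; suc)
open import Data.Integer as ℤ using (ℤ; _<_; _<?_; _-_; +_)
open import Data.Fin using (Fin; zero; suc; _≟_; fromℕ; inject₁)
open import Data.List using (List; []; _∷_; map; concatMap; filter; length)
open import Data.List.Relation.Unary.All using (All)
open import Data.Bool using (Bool; true; false; if_then_else_)
open import Relation.Nullary using (Dec; yes; no; does)
open import Relation.Nullary.Decidable using (_×-dec_)
open import Data.Product using (_×_)
open import Data.Fin.Properties using (all?)
open import Data.List using (allFin)

Point : ℕ → Set
Point n = Fin n → ℤ

e : ∀ {n} → Fin n → Point n
e j i = if does (i ≟ j) then + 1 else + 0

_+ᵖ_ : ∀ {n} → Point n → Point n → Point n
(p +ᵖ q) i = p i ℤ.+ q i

-ᵖ_ : ∀ {n} → Point n → Point n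
(-ᵖ p) i = ℤ.- (p i)

positiveSteps : (n : ℕ) → List (Point n)
positiveSteps n = map e (allFin n)

standardSteps : (n : ℕ) → List (Point n)
standardSteps n = map e (allFin n) Data.List.++ map (λ j → -ᵖ e j) (allFin n)

-- The alcove A^{Ã_{n-1}}_m for n ≥ 1 (dimension written suc n):
-- x_1 > x_2 > ... > x_{n} > x_1 - m   (indices 0 .. n here).
InAlcove : (n m : ℕ) → Point (suc n) → Set
InAlcove n m x =
  ((i : Fin n) → x (suc i) < x (inject₁ i)) ×
  (x zero - + m < x (fromℕ n))

inAlcove? : (n m : ℕ) → (x : Point (suc n)) → Dec (InAlcove n m x)
inAlcove? n m x =
  all? (λ i → x (suc i) ℤ.<? x (inject₁ i)) ×-dec (x zero - + m ℤ.<? x (fromℕ n))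

-- A walk is a list of points p_0, ..., p_k.
-- All walks with exactly k steps from S starting at p (each step sequence
-- gives a distinct walk since p_i - p_{i-1} recovers the step).
walksFrom : ∀ {n} → List (Point n) → ℕ → Point n → List (List (Point n))
walksFrom S zero p = (p ∷ []) ∷ []
walksFrom S (suc k) p =
  concatMap (λ s → map (p ∷_) (walksFrom S k (p +ᵖ s))) S

countWalks : (n m : ℕ) → List (Point (suc n)) → ℕ → Point (suc n) → ℕ
countWalks n m S k η =
  length (filter (λ w → Data.List.Relation.Unary.All.all? (inAlcove? n m) w)
                 (walksFrom S k η))

-- Write c⁺ₖ p and c±ₖ p for the numbers of k-step walks from p with positive, resp. standard,
-- steps that stay in a region A, χ for the indicator of A, and (U f) p = Σᵢ f (p + eᵢ),
-- (D f) p = Σⱼ f (p − eⱼ).  Then c⁺ₖ₊₁ = χ · U c⁺ₖ and c±ₖ₊₁ = χ · (U + D) c±ₖ, so c±ₖ = 2ᵏ c⁺ₖ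
-- follows by induction once D c⁺ₖ = U c⁺ₖ on A.  That in turn follows by induction from
-- D (χ · U f) = U (χ · D f) on A, for f vanishing off A.  Expanding both sides as double sums
-- over (i, j), the terms with i ≢ j agree because whenever p and p + eᵢ − eⱼ lie in A, so do
-- p + eᵢ and p − eⱼ (A is cut out by walls of the form x_lo + c < x_hi), and the diagonal terms
-- agree because for p ∈ A as many points p + eᵢ as points p − eⱼ lie in A: going around the
-- cycle of walls of the alcove, p + e₍ₗ₊₁₎ and p − eₗ leave A exactly when the wall between
-- coordinates l and l + 1 is tight.

module Submission where

open import Defs
open import Data.Nat using (ℕ; zero; suc; _+_; _*_; _^_; NonZero; z≤n)
open import Relation.Binary.PropositionalEquality
  using (_≡_; _≢_; _≗_; refl; sym; trans; cong; cong₂; subst; subst₂; module ≡-Reasoning)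
open import Data.Nat.Properties
  using (+-*-semiring; +-comm; +-identityʳ; *-zeroʳ; *-identityʳ; *-distribˡ-+)
import Data.Nat.ListAction as ListAction
open import Data.Nat.ListAction.Properties using (sum-++)
open import Data.Nat.Tactic.RingSolver using (solve-∀)
import Data.Integer as ℤ
import Data.Integer.Properties as ℤ
import Data.Integer.Tactic.RingSolver as ℤ-Solver
open import Algebra.Properties.Semiring.Sum +-*-semiring
  using ( sum; sum-syntax; sum-cong-≗; sum-remove; sum-init-last; ∑-distrib-+; ∑-comm
        ; *-distribˡ-sum; *-distribʳ-sum)
open import Data.Fin using (Fin; zero; suc; punchIn; inject₁; fromℕ)
open import Data.Fin.Properties using (_≟_; punchInᵢ≢i; suc-injective; inject₁-injective; fromℕ≢inject₁)
open import Data.List using (List; []; _∷_; map; concatMap; filter; length; tabulate; allFin; _++_)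
open import Data.List.Properties using (filter-++; length-++; map-tabulate; map-++; map-cong)
open import Data.List.Relation.Unary.All using (all?)
open import Data.Product using (_×_; _,_; proj₁; proj₂)
open import Function using (_∘_)
open import Relation.Nullary using (Dec; yes; no; ¬_; contradiction)
open import Relation.Unary using (Decidable)
open import Relation.Binary.Definitions using (_Respects_)

open ≡-Reasoning

∑∑-cong-offDiagonal : ∀ {N} (a b : Fin N → Fin N → ℕ) →
  (∀ {i j} → i ≢ j → a i j ≡ b i j) → ∑[ i < N ] a i i ≡ ∑[ i < N ] b i i →
  ∑[ i < N ] ∑[ j < N ] a i j ≡ ∑[ i < N ] ∑[ j < N ] b i j
∑∑-cong-offDiagonal {zero}  a b _ _ = refl
∑∑-cong-offDiagonal {suc N} a b offDiagonal diagonal = begin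
  ∑[ i < suc N ] ∑[ j < suc N ] a i j
    ≡⟨ sum-cong-≗ (λ i → sum-remove {i = i} (a i)) ⟩
  ∑[ i < suc N ] (a i i + ∑[ j < N ] a i (punchIn i j))
    ≡⟨ ∑-distrib-+ (λ i → a i i) (λ i → ∑[ j < N ] a i (punchIn i j)) ⟩
  ∑[ i < suc N ] a i i + ∑[ i < suc N ] ∑[ j < N ] a i (punchIn i j)
    ≡⟨ cong₂ _+_ diagonal (sum-cong-≗ λ i → sum-cong-≗ λ j → offDiagonal (punchInᵢ≢i i j ∘ sym)) ⟩
  ∑[ i < suc N ] b i i + ∑[ i < suc N ] ∑[ j < N ] b i (punchIn i j)
    ≡⟨ ∑-distrib-+ (λ i → b i i) (λ i → ∑[ j < N ] b i (punchIn i j)) ⟨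
  ∑[ i < suc N ] (b i i + ∑[ j < N ] b i (punchIn i j))
    ≡⟨ sum-cong-≗ (λ i → sum-remove {i = i} (b i)) ⟨
  ∑[ i < suc N ] ∑[ j < suc N ] b i j ∎

sum-tabulate : ∀ {N} (f : Fin N → ℕ) → ListAction.sum (tabulate f) ≡ sum f
sum-tabulate {zero}  f = refl
sum-tabulate {suc N} f = cong (f zero +_) (sum-tabulate (f ∘ suc))

sum-map-allFin : ∀ {N} {A : Set} (f : Fin N → A) (g : A → ℕ) →
  ListAction.sum (map g (map f (allFin N))) ≡ ∑[ i < N ] g (f i)
sum-map-allFin f g = begin
  ListAction.sum (map g (map f (allFin _)))
    ≡⟨ cong (ListAction.sum ∘ map g) (map-tabulate (λ i → i) f) ⟩
  ListAction.sum (map g (tabulate f))   ≡⟨ cong ListAction.sum (map-tabulate f g) ⟩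
  ListAction.sum (tabulate (g ∘ f))     ≡⟨ sum-tabulate (g ∘ f) ⟩
  ∑[ i < _ ] g (f i)                    ∎

i+j+k≡i+k+j : ∀ i j k → i ℤ.+ j ℤ.+ k ≡ i ℤ.+ k ℤ.+ j
i+j+k≡i+k+j = ℤ-Solver.solve-∀

i+j-j≡i : ∀ i j → i ℤ.+ j ℤ.- j ≡ i
i+j-j≡i = ℤ-Solver.solve-∀

i-j+j≡i : ∀ i j → i ℤ.- j ℤ.+ j ≡ i
i-j+j≡i = ℤ-Solver.solve-∀

i+j-k≡i-k+j : ∀ i j k → i ℤ.+ j ℤ.- k ≡ i ℤ.- k ℤ.+ j
i+j-k≡i-k+j = ℤ-Solver.solve-∀

i-k+[j+k]≡i+j : ∀ i j k → i ℤ.- k ℤ.+ (j ℤ.+ k) ≡ i ℤ.+ j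
i-k+[j+k]≡i+j = ℤ-Solver.solve-∀

+-cancelʳ-< : ∀ {i j} k → i ℤ.+ k ℤ.< j ℤ.+ k → i ℤ.< j
+-cancelʳ-< {i} {j} k i+k<j+k = subst₂ ℤ._<_ (i+j-j≡i i k) (i+j-j≡i j k) (ℤ.+-monoˡ-< (ℤ.- k) i+k<j+k)

e-diagonal : ∀ {N} (i : Fin N) → e i i ≡ ℤ.1ℤ
e-diagonal i with i ≟ i
... | yes _   = refl
... | no i≢i = contradiction refl i≢i

e-offDiagonal : ∀ {N} {i x : Fin N} → x ≢ i → e i x ≡ ℤ.0ℤ
e-offDiagonal {i = i} {x} x≢i with x ≟ i
... | yes x≡i = contradiction x≡i x≢i
... | no  _   = refl

e-sym : ∀ {N} (i x : Fin N) → e i x ≡ e x i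
e-sym i x = symmetric (x ≟ i)
  where
  symmetric : Dec (x ≡ i) → e i x ≡ e x i
  symmetric (yes x≡i) = cong₂ e (sym x≡i) x≡i
  symmetric (no  x≢i) = trans (e-offDiagonal x≢i) (sym (e-offDiagonal (x≢i ∘ sym)))

0≤e : ∀ {N} (i x : Fin N) → ℤ.0ℤ ℤ.≤ e i x
0≤e i x with x ≟ i
... | yes _ = ℤ.+≤+ z≤n
... | no  _ = ℤ.+≤+ z≤n

e-off≤ : ∀ {N} {i : Fin N} x y → x ≢ i → e i x ℤ.≤ e i y
e-off≤ x y x≢i = subst (ℤ._≤ _) (sym (e-offDiagonal x≢i)) (0≤e _ y)

p+s+t≗p+t+s : ∀ {N} (p s t : Point N) → (p +ᵖ s) +ᵖ t ≗ (p +ᵖ t) +ᵖ s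
p+s+t≗p+t+s p s t x = i+j+k≡i+k+j (p x) (s x) (t x)

p+s-s≗p : ∀ {N} (p s : Point N) → (p +ᵖ s) +ᵖ (-ᵖ s) ≗ p
p+s-s≗p p s x = i+j-j≡i (p x) (s x)

p-t+[s+t]≗p+s : ∀ {N} (p s t : Point N) → (p +ᵖ (-ᵖ t)) +ᵖ (s +ᵖ t) ≗ p +ᵖ s
p-t+[s+t]≗p+s p s t x = i-k+[j+k]≡i+j (p x) (s x) (t x)

p-s+s≗p : ∀ {N} (p s : Point N) → (p +ᵖ (-ᵖ s)) +ᵖ s ≗ p
p-s+s≗p p s x = i-j+j≡i (p x) (s x)

module WalkCount {N : ℕ} {R : Point N → Set} (R? : Decidable R) where

  χ : Point N → ℕ
  χ p with R? p
  ... | yes _ = 1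
  ... | no  _ = 0

  χ-inside : ∀ {p} → R p → χ p ≡ 1
  χ-inside {p} Rp with R? p
  ... | yes _  = refl
  ... | no ¬Rp = contradiction Rp ¬Rp

  χ-outside : ∀ {p} → ¬ R p → χ p ≡ 0
  χ-outside {p} ¬Rp with R? p
  ... | yes Rp = contradiction Rp ¬Rp
  ... | no  _  = refl

  χ-cong : ∀ {p q} → (R p → R q) → (R q → R p) → χ p ≡ χ q
  χ-cong {p} {q} p⇒q q⇒p with R? p | R? q
  ... | yes _  | yes _  = refl
  ... | yes Rp | no ¬Rq = contradiction (p⇒q Rp) ¬Rq
  ... | no ¬Rp | yes Rq = contradiction (q⇒p Rq) ¬Rp
  ... | no _   | no _   = refl

  χ-*-cong : ∀ {p x y} → (R p → x ≡ y) → χ p * x ≡ χ p * y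
  χ-*-cong {p} x≡y with R? p
  ... | yes Rp = cong (_+ 0) (x≡y Rp)
  ... | no  _  = refl

  count : List (Point N) → ℕ → Point N → ℕ
  count S k p = length (filter (all? R?) (walksFrom S k p))

  length-filter-++ : ∀ (ws vs : List (List (Point N))) →
    length (filter (all? R?) (ws ++ vs)) ≡ length (filter (all? R?) ws) + length (filter (all? R?) vs)
  length-filter-++ ws vs =
    trans (cong length (filter-++ (all? R?) ws vs)) (length-++ (filter (all? R?) ws))

  length-filter-map-∷-inside : ∀ {p} → R p → ∀ (ws : List (List (Point N))) →
    length (filter (all? R?) (map (p ∷_) ws)) ≡ length (filter (all? R?) ws)
  length-filter-map-∷-inside Rp [] = refl
  length-filter-map-∷-inside {p} Rp (w ∷ ws) with R? p | all? R? w
  ... | yes _  | yes _ = cong suc (length-filter-map-∷-inside Rp ws)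
  ... | yes _  | no  _ = length-filter-map-∷-inside Rp ws
  ... | no ¬Rp | _     = contradiction Rp ¬Rp

  length-filter-map-∷-outside : ∀ {p} → ¬ R p → ∀ (ws : List (List (Point N))) →
    length (filter (all? R?) (map (p ∷_) ws)) ≡ 0
  length-filter-map-∷-outside ¬Rp [] = refl
  length-filter-map-∷-outside {p} ¬Rp (w ∷ ws) with R? p
  ... | yes Rp = contradiction Rp ¬Rp
  ... | no  _  = length-filter-map-∷-outside ¬Rp ws

  length-filter-map-∷ : ∀ p (ws : List (List (Point N))) →
    length (filter (all? R?) (map (p ∷_) ws)) ≡ χ p * length (filter (all? R?) ws)
  length-filter-map-∷ p ws with R? p
  ... | yes Rp = trans (length-filter-map-∷-inside Rp ws) (sym (+-identityʳ _))
  ... | no ¬Rp = length-filter-map-∷-outside ¬Rp ws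

  count-zero : ∀ S p → count S 0 p ≡ χ p
  count-zero S p = trans (length-filter-map-∷ p ([] ∷ [])) (*-identityʳ (χ p))

  count-suc : ∀ S k p → count S (suc k) p ≡ χ p * ListAction.sum (map (λ s → count S k (p +ᵖ s)) S)
  count-suc S k p = split S
    where
    walksVia : Point N → List (List (Point N))
    walksVia s = map (p ∷_) (walksFrom S k (p +ᵖ s))
    split : ∀ T → length (filter (all? R?) (concatMap walksVia T))
                  ≡ χ p * ListAction.sum (map (λ s → count S k (p +ᵖ s)) T)
    split []      = sym (*-zeroʳ (χ p))
    split (s ∷ T) = begin
      length (filter (all? R?) (walksVia s ++ concatMap walksVia T))
        ≡⟨ length-filter-++ (walksVia s) (concatMap walksVia T) ⟩
      length (filter (all? R?) (walksVia s)) + length (filter (all? R?) (concatMap walksVia T))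
        ≡⟨ cong₂ _+_ (length-filter-map-∷ p (walksFrom S k (p +ᵖ s))) (split T) ⟩
      χ p * count S k (p +ᵖ s) + χ p * ListAction.sum (map (λ s → count S k (p +ᵖ s)) T)
        ≡⟨ *-distribˡ-+ (χ p) _ _ ⟨
      χ p * ListAction.sum (map (λ s → count S k (p +ᵖ s)) (s ∷ T)) ∎

  count-outside : ∀ {p} → ¬ R p → ∀ S k → count S k p ≡ 0
  count-outside {p} ¬Rp S zero    = trans (count-zero S p) (χ-outside ¬Rp)
  count-outside {p} ¬Rp S (suc k) rewrite count-suc S k p | χ-outside ¬Rp = refl

  up down : (Point N → ℕ) → Point N → ℕ
  up   f p = ∑[ i < N ] f (p +ᵖ e i)
  down f p = ∑[ j < N ] f (p +ᵖ (-ᵖ e j))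

  up-cong : ∀ {f g} → f ≗ g → up f ≗ up g
  up-cong f≗g p = sum-cong-≗ (λ i → f≗g (p +ᵖ e i))

  down-cong : ∀ {f g} → f ≗ g → down f ≗ down g
  down-cong f≗g p = sum-cong-≗ (λ j → f≗g (p +ᵖ (-ᵖ e j)))

  count⁺ count± : ℕ → Point N → ℕ
  count⁺ = count (positiveSteps N)
  count± = count (standardSteps N)

  count⁺-suc : ∀ k p → count⁺ (suc k) p ≡ χ p * up (count⁺ k) p
  count⁺-suc k p =
    trans (count-suc (positiveSteps N) k p) (cong (χ p *_) (sum-map-allFin e (λ s → count⁺ k (p +ᵖ s))))

  count±-suc : ∀ k p → count± (suc k) p ≡ χ p * (up (count± k) p + down (count± k) p)
  count±-suc k p = trans (count-suc (standardSteps N) k p) (cong (χ p *_) (begin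
    ListAction.sum (map next (map e (allFin N) ++ map (-ᵖ_ ∘ e) (allFin N)))
      ≡⟨ cong ListAction.sum (map-++ next (map e (allFin N)) _) ⟩
    ListAction.sum (map next (map e (allFin N)) ++ map next (map (-ᵖ_ ∘ e) (allFin N)))
      ≡⟨ sum-++ (map next (map e (allFin N))) _ ⟩
    ListAction.sum (map next (map e (allFin N))) + ListAction.sum (map next (map (-ᵖ_ ∘ e) (allFin N)))
      ≡⟨ cong₂ _+_ (sum-map-allFin e next) (sum-map-allFin (-ᵖ_ ∘ e) next) ⟩
    up (count± k) p + down (count± k) p ∎))
    where
    next : Point N → ℕ
    next s = count± k (p +ᵖ s)

  module _ (R-resp : R Respects _≗_) where

    χ-resp : ∀ {p q} → p ≗ q → χ p ≡ χ q
    χ-resp p≗q = χ-cong (R-resp p≗q) (R-resp (sym ∘ p≗q))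

    count-resp : ∀ S k {p q} → p ≗ q → count S k p ≡ count S k q
    count-resp S zero {p} {q} p≗q = begin
      count S 0 p ≡⟨ count-zero S p ⟩
      χ p         ≡⟨ χ-resp p≗q ⟩
      χ q         ≡⟨ count-zero S q ⟨
      count S 0 q ∎
    count-resp S (suc k) {p} {q} p≗q = begin
      count S (suc k) p
        ≡⟨ count-suc S k p ⟩
      χ p * ListAction.sum (map (λ s → count S k (p +ᵖ s)) S)
        ≡⟨ cong₂ _*_ (χ-resp p≗q) (cong ListAction.sum (map-cong (λ s → count-resp S k (p+s≗q+s s)) S)) ⟩
      χ q * ListAction.sum (map (λ s → count S k (q +ᵖ s)) S)
        ≡⟨ count-suc S k q ⟨
      count S (suc k) q ∎
      where
      p+s≗q+s : ∀ s → p +ᵖ s ≗ q +ᵖ s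
      p+s≗q+s s x = cong (ℤ._+ s x) (p≗q x)

    module _ (up-χ≡down-χ : ∀ p → R p → up χ p ≡ down χ p)
             (between : ∀ p {i j} → i ≢ j → R p → R ((p +ᵖ e i) +ᵖ (-ᵖ e j)) →
                        R (p +ᵖ e i) × R (p +ᵖ (-ᵖ e j)))
             where

      down-χ·up≡up-χ·down : (f : Point N → ℕ) →
        (∀ {p q} → p ≗ q → f p ≡ f q) → (∀ {q} → ¬ R q → f q ≡ 0) →
        ∀ {p} → R p → down (λ q → χ q * up f q) p ≡ up (λ q → χ q * down f q) p
      down-χ·up≡up-χ·down f f-resp f-outside {p} Rp = begin
        ∑[ j < N ] (χ (p⁻ j) * ∑[ i < N ] f (p⁻ j +ᵖ e i))
          ≡⟨ sum-cong-≗ (λ j → *-distribˡ-sum (χ (p⁻ j)) (λ i → f (p⁻ j +ᵖ e i))) ⟩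
        ∑[ j < N ] ∑[ i < N ] a i j
          ≡⟨ ∑-comm (λ j i → a i j) ⟩
        ∑[ i < N ] ∑[ j < N ] a i j
          ≡⟨ ∑∑-cong-offDiagonal a b offDiagonal diagonal ⟩
        ∑[ i < N ] ∑[ j < N ] b i j
          ≡⟨ sum-cong-≗ (λ i → *-distribˡ-sum (χ (p⁺ i)) (λ j → f (p⁺ i +ᵖ (-ᵖ e j)))) ⟨
        ∑[ i < N ] (χ (p⁺ i) * ∑[ j < N ] f (p⁺ i +ᵖ (-ᵖ e j))) ∎
        where
        p⁺ p⁻ : Fin N → Point N
        p⁺ i = p +ᵖ e i
        p⁻ j = p +ᵖ (-ᵖ e j)
        a b : Fin N → Fin N → ℕ
        a i j = χ (p⁻ j) * f (p⁻ j +ᵖ e i)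
        b i j = χ (p⁺ i) * f (p⁺ i +ᵖ (-ᵖ e j))

        diagonal : ∑[ i < N ] a i i ≡ ∑[ i < N ] b i i
        diagonal = begin
          ∑[ i < N ] (χ (p⁻ i) * f (p⁻ i +ᵖ e i))
            ≡⟨ sum-cong-≗ (λ i → cong (χ (p⁻ i) *_) (f-resp (p-s+s≗p p (e i)))) ⟩
          ∑[ i < N ] (χ (p⁻ i) * f p)   ≡⟨ *-distribʳ-sum (f p) (χ ∘ p⁻) ⟨
          down χ p * f p                 ≡⟨ cong (_* f p) (up-χ≡down-χ p Rp) ⟨
          up χ p * f p                   ≡⟨ *-distribʳ-sum (f p) (χ ∘ p⁺) ⟩
          ∑[ i < N ] (χ (p⁺ i) * f p)
            ≡⟨ sum-cong-≗ (λ i → cong (χ (p⁺ i) *_) (f-resp (p+s-s≗p p (e i)))) ⟨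
          ∑[ i < N ] (χ (p⁺ i) * f (p⁺ i +ᵖ (-ᵖ e i))) ∎

        offDiagonal : ∀ {i j} → i ≢ j → a i j ≡ b i j
        offDiagonal {i} {j} i≢j =
          trans (cong (χ (p⁻ j) *_) (f-resp (p+s+t≗p+t+s p (-ᵖ e j) (e i)))) (weights (R? q))
          where
          q : Point N
          q = p⁺ i +ᵖ (-ᵖ e j)
          weights : Dec (R q) → χ (p⁻ j) * f q ≡ χ (p⁺ i) * f q
          weights (yes Rq) with between p i≢j Rp Rq
          ... | Rp⁺ , Rp⁻ = cong (_* f q) (trans (χ-inside Rp⁻) (sym (χ-inside Rp⁺)))
          weights (no ¬Rq) rewrite f-outside ¬Rq = trans (*-zeroʳ (χ (p⁻ j))) (sym (*-zeroʳ (χ (p⁺ i))))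

      down≡up-count⁺ : ∀ k {p} → R p → down (count⁺ k) p ≡ up (count⁺ k) p
      down≡up-count⁺ zero {p} Rp = begin
        down (count⁺ 0) p ≡⟨ down-cong (count-zero (positiveSteps N)) p ⟩
        down χ p          ≡⟨ up-χ≡down-χ p Rp ⟨
        up χ p            ≡⟨ up-cong (count-zero (positiveSteps N)) p ⟨
        up (count⁺ 0) p   ∎
      down≡up-count⁺ (suc k) {p} Rp = begin
        down (count⁺ (suc k)) p                 ≡⟨ down-cong (count⁺-suc k) p ⟩
        down (λ q → χ q * up (count⁺ k) q) p
          ≡⟨ down-χ·up≡up-χ·down (count⁺ k) (count-resp (positiveSteps N) k)
                                 (λ ¬Rq → count-outside ¬Rq (positiveSteps N) k) Rp ⟩
        up (λ q → χ q * down (count⁺ k) q) p    ≡⟨ up-cong (λ q → χ-*-cong {q} (down≡up-count⁺ k)) p ⟩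
        up (λ q → χ q * up (count⁺ k) q) p      ≡⟨ up-cong (count⁺-suc k) p ⟨
        up (count⁺ (suc k)) p                   ∎

      count±≡2^k*count⁺ : ∀ k p → count± k p ≡ 2 ^ k * count⁺ k p
      count±≡2^k*count⁺ zero p = begin
        count± 0 p     ≡⟨ count-zero (standardSteps N) p ⟩
        χ p            ≡⟨ count-zero (positiveSteps N) p ⟨
        count⁺ 0 p     ≡⟨ +-identityʳ (count⁺ 0 p) ⟨
        1 * count⁺ 0 p ∎
      count±≡2^k*count⁺ (suc k) p = begin
        count± (suc k) p
          ≡⟨ count±-suc k p ⟩
        χ p * (up (count± k) p + down (count± k) p)
          ≡⟨ cong (χ p *_) (cong₂ _+_ (scaled (p +ᵖ_ ∘ e)) (scaled (p +ᵖ_ ∘ -ᵖ_ ∘ e))) ⟩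
        χ p * (2 ^ k * up⁺ + 2 ^ k * down (count⁺ k) p)
          ≡⟨ χ-*-cong (λ Rp → cong (λ d → 2 ^ k * up⁺ + 2 ^ k * d) (down≡up-count⁺ k Rp)) ⟩
        χ p * (2 ^ k * up⁺ + 2 ^ k * up⁺)
          ≡⟨ doubling (χ p) (2 ^ k) up⁺ ⟩
        2 ^ suc k * (χ p * up⁺)
          ≡⟨ cong (2 ^ suc k *_) (count⁺-suc k p) ⟨
        2 ^ suc k * count⁺ (suc k) p ∎
        where
        up⁺ : ℕ
        up⁺ = up (count⁺ k) p
        scaled : (neighbour : Fin N → Point N) →
          ∑[ i < N ] count± k (neighbour i) ≡ 2 ^ k * ∑[ i < N ] count⁺ k (neighbour i)
        scaled neighbour = trans (sum-cong-≗ (λ i → count±≡2^k*count⁺ k (neighbour i)))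
                                 (sym (*-distribˡ-sum (2 ^ k) (λ i → count⁺ k (neighbour i))))
        doubling : ∀ c a u → c * (a * u + a * u) ≡ (2 * a) * (c * u)
        doubling = solve-∀

-- Both kinds of alcove walls, x (suc l) < x (inject₁ l) and x zero - m < x (fromℕ n), have the
-- form φ (x lo) < x hi for a translation φ, so that InAlcove n m x unfolds definitionally to a
-- conjunction of Below's.

IsTranslation : (ℤ.ℤ → ℤ.ℤ) → Set
IsTranslation φ = ∀ z w → φ (z ℤ.+ w) ≡ φ z ℤ.+ w

Below : ∀ {N} → (ℤ.ℤ → ℤ.ℤ) → Fin N → Fin N → Point N → Set
Below φ lo hi x = φ (x lo) ℤ.< x hi

module Wall {N} {φ : ℤ.ℤ → ℤ.ℤ} (φ-translation : IsTranslation φ) (lo hi : Fin N) where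

  resp : Below φ lo hi Respects _≗_
  resp p≗q = subst₂ ℤ._<_ (cong φ (p≗q lo)) (p≗q hi)

  private
    same-slack : (e lo +ᵖ e hi) lo ≡ (e lo +ᵖ e hi) hi
    same-slack rewrite e-diagonal lo | e-diagonal hi | e-sym lo hi = ℤ.+-comm ℤ.1ℤ (e hi lo)

  shift : ∀ p s → Below φ lo hi p → s lo ℤ.≤ s hi → Below φ lo hi (p +ᵖ s)
  shift p s below lo≤hi =
    subst (ℤ._< _) (sym (φ-translation (p lo) (s lo))) (ℤ.+-mono-<-≤ below lo≤hi)

  unshift : ∀ p s → Below φ lo hi (p +ᵖ s) → s hi ℤ.≤ s lo → Below φ lo hi p
  unshift p s below hi≤lo =
    +-cancelʳ-< (s lo) (ℤ.<-≤-trans (subst (ℤ._< _) (φ-translation (p lo) (s lo)) below)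
                                     (ℤ.+-monoʳ-≤ (p hi) hi≤lo))

  -- p + e lo and p − e hi differ by e lo + e hi, which moves both ends of the wall equally.
  raise⇒lower : ∀ p → Below φ lo hi (p +ᵖ e lo) → Below φ lo hi (p +ᵖ (-ᵖ e hi))
  raise⇒lower p below =
    unshift (p +ᵖ (-ᵖ e hi)) (e lo +ᵖ e hi) (resp (sym ∘ p-t+[s+t]≗p+s p (e lo) (e hi)) below)
            (ℤ.≤-reflexive (sym same-slack))

  lower⇒raise : ∀ p → Below φ lo hi (p +ᵖ (-ᵖ e hi)) → Below φ lo hi (p +ᵖ e lo)
  lower⇒raise p below =
    resp (p-t+[s+t]≗p+s p (e lo) (e hi))
         (shift (p +ᵖ (-ᵖ e hi)) (e lo +ᵖ e hi) below (ℤ.≤-reflexive same-slack))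

  between : ∀ p {i j} → i ≢ j → Below φ lo hi p → Below φ lo hi ((p +ᵖ e i) +ᵖ (-ᵖ e j)) →
            Below φ lo hi (p +ᵖ e i) × Below φ lo hi (p +ᵖ (-ᵖ e j))
  between p {i} {j} i≢j below below′ = raised (lo ≟ i) , lowered (hi ≟ j)
    where
    raised : Dec (lo ≡ i) → Below φ lo hi (p +ᵖ e i)
    raised (no lo≢i)  = shift p (e i) below (e-off≤ lo hi lo≢i)
    raised (yes lo≡i) =
      unshift (p +ᵖ e i) (-ᵖ e j) below′ (ℤ.neg-mono-≤ (e-off≤ lo hi (i≢j ∘ trans (sym lo≡i))))
    lowered : Dec (hi ≡ j) → Below φ lo hi (p +ᵖ (-ᵖ e j))
    lowered (no hi≢j)  = shift p (-ᵖ e j) below (ℤ.neg-mono-≤ (e-off≤ hi lo hi≢j))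
    lowered (yes hi≡j) = unshift (p +ᵖ (-ᵖ e j)) (e i) (resp (p+s+t≗p+t+s p (e i) (-ᵖ e j)) below′)
                                 (e-off≤ hi lo (λ hi≡i → i≢j (trans (sym hi≡i) hi≡j)))

module Alcove (n m : ℕ) where

  open WalkCount (inAlcove? n m) using (χ; χ-cong; up; down)

  DescentWall : Fin n → Point (suc n) → Set
  DescentWall l = Below (λ z → z) (suc l) (inject₁ l)

  WrapWall : Point (suc n) → Set
  WrapWall = Below (ℤ._- ℤ.+ m) zero (fromℕ n)

  module Descent (l : Fin n) = Wall {φ = λ z → z} (λ _ _ → refl) (suc l) (inject₁ l)
  module Wrap = Wall {φ = ℤ._- ℤ.+ m} (λ z w → i+j-k≡i-k+j z w (ℤ.+ m)) zero (fromℕ n)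

  resp : InAlcove n m Respects _≗_
  resp p≗q (descents , wrap) = (λ l → Descent.resp l p≗q (descents l)) , Wrap.resp p≗q wrap

  between : ∀ p {i j} → i ≢ j → InAlcove n m p → InAlcove n m ((p +ᵖ e i) +ᵖ (-ᵖ e j)) →
            InAlcove n m (p +ᵖ e i) × InAlcove n m (p +ᵖ (-ᵖ e j))
  between p {i} {j} i≢j (descents , wrap) (descents′ , wrap′) =
    ((λ l → proj₁ (descent l)) , proj₁ (Wrap.between p i≢j wrap wrap′)) ,
    ((λ l → proj₂ (descent l)) , proj₂ (Wrap.between p i≢j wrap wrap′))
    where
    descent : ∀ l → DescentWall l (p +ᵖ e i) × DescentWall l (p +ᵖ (-ᵖ e j))
    descent l = Descent.between l p i≢j (descents l) (descents′ l)

  shift-descent : ∀ p s i → InAlcove n m p →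
    (∀ l → l ≢ i → s (suc l) ℤ.≤ s (inject₁ l)) → s zero ℤ.≤ s (fromℕ n) →
    DescentWall i (p +ᵖ s) → InAlcove n m (p +ᵖ s)
  shift-descent p s i (descents , wrap) keeps-descents keeps-wrap descentᵢ =
    descents′ , Wrap.shift p s wrap keeps-wrap
    where
    descents′ : ∀ l → DescentWall l (p +ᵖ s)
    descents′ l with l ≟ i
    ... | yes refl = descentᵢ
    ... | no l≢i   = Descent.shift l p s (descents l) (keeps-descents l l≢i)

  shift-wrap : ∀ p s → InAlcove n m p →
    (∀ l → s (suc l) ℤ.≤ s (inject₁ l)) → WrapWall (p +ᵖ s) → InAlcove n m (p +ᵖ s)
  shift-wrap p s (descents , _) keeps-descents wrap′ =
    (λ l → Descent.shift l p s (descents l) (keeps-descents l)) , wrap′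

  χ-raise-suc≡χ-lower-inject₁ : ∀ p i → InAlcove n m p →
    χ (p +ᵖ e (suc i)) ≡ χ (p +ᵖ (-ᵖ e (inject₁ i)))
  χ-raise-suc≡χ-lower-inject₁ p i inside = χ-cong
    (λ raised → shift-descent p (-ᵖ e (inject₁ i)) i inside
       (λ l l≢i → ℤ.neg-mono-≤ (e-off≤ (inject₁ l) (suc l) (l≢i ∘ inject₁-injective)))
       (ℤ.neg-mono-≤ (e-off≤ (fromℕ n) zero (fromℕ≢inject₁ {i = i})))
       (Descent.raise⇒lower i p (proj₁ raised i)))
    (λ lowered → shift-descent p (e (suc i)) i inside
       (λ l l≢i → e-off≤ (suc l) (inject₁ l) (l≢i ∘ suc-injective))
       (e-off≤ zero (fromℕ n) (λ ()))
       (Descent.lower⇒raise i p (proj₁ lowered i)))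

  χ-raise-zero≡χ-lower-last : ∀ p → InAlcove n m p → χ (p +ᵖ e zero) ≡ χ (p +ᵖ (-ᵖ e (fromℕ n)))
  χ-raise-zero≡χ-lower-last p inside = χ-cong
    (λ raised → shift-wrap p (-ᵖ e (fromℕ n)) inside
       (λ l → ℤ.neg-mono-≤ (e-off≤ (inject₁ l) (suc l) (fromℕ≢inject₁ ∘ sym)))
       (Wrap.raise⇒lower p (proj₂ raised)))
    (λ lowered → shift-wrap p (e zero) inside
       (λ l → e-off≤ (suc l) (inject₁ l) (λ ()))
       (Wrap.lower⇒raise p (proj₂ lowered)))

  up-χ≡down-χ : ∀ p → InAlcove n m p → up χ p ≡ down χ p
  up-χ≡down-χ p inside = begin
    χ (p +ᵖ e zero) + ∑[ i < n ] χ (p +ᵖ e (suc i))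
      ≡⟨ cong₂ _+_ (χ-raise-zero≡χ-lower-last p inside)
                   (sum-cong-≗ {n} (λ i → χ-raise-suc≡χ-lower-inject₁ p i inside)) ⟩
    χ (p +ᵖ (-ᵖ e (fromℕ n))) + ∑[ i < n ] χ (p +ᵖ (-ᵖ e (inject₁ i)))
      ≡⟨ +-comm (χ (p +ᵖ (-ᵖ e (fromℕ n)))) _ ⟩
    ∑[ i < n ] χ (p +ᵖ (-ᵖ e (inject₁ i))) + χ (p +ᵖ (-ᵖ e (fromℕ n)))
      ≡⟨ sum-init-last (λ j → χ (p +ᵖ (-ᵖ e j))) ⟨
    down χ p ∎

lemma14 : (n m : ℕ) → .{{_ : NonZero m}} → (η : Point (suc n)) →
    InAlcove n m η → (k : ℕ) →
    2 ^ k * countWalks n m (positiveSteps (suc n)) k η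
      ≡ countWalks n m (standardSteps (suc n)) k η
lemma14 n m η _ k = sym (WalkCount.count±≡2^k*count⁺ (inAlcove? n m) resp up-χ≡down-χ between k η)
  where open Alcove n m
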